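{- Let $n=sm$ with $m\ge1$, $s\ge2$, $n-m\equiv0\pmod 6$, $V=\mathbb{F}_{2^n}$ viewed as an $\mathbb{F}_2$-space, $\xi$ a primitive element of $\mathbb{F}_{2^n}$, $g=(2^n-1)/(2^m-1)$, $K=\mathbb{Z}_{2^n-1}\setminus\{0\}$, $\overline{K}=\{k\in K: g\nmid k\}$. Let $G=\{y\mapsto ay: a\in\mathbb{F}_{2^n}^*\}$ and for a $2$-dimensional $\mathbb{F}_2$-subspace $U$ let $\mathrm{orb}(U)=\{\pi(U):\pi\in G\}$. Then for every $2$-dimensional $\mathbb{F}_2$-subspace $U$ of $V$ there is $k\in K$ such that $$\mathrm{orb}(U)=\mathrm{orb}\langle\xi^k,\xi^{\mathrm{Z}(k)}\rangle=\mathrm{orb}\langle\xi^{ -k},\xi^{\mathrm{Z}(-k)}\rangle=\mathrm{orb}\langle\xi^{ -\mathrm{Z}(-k)},\xi^{ -\mathrm{Z}(k)}\rangle.$$ Moreover, the subspaces $\langle\xi^k,\xi^{\mathrm{Z}(k)}\rangle$, $\langle\xi^{ -k},\xi^{\mathrm{Z}(-k)}\rangle$, $\langle\xi^{ -\mathrm{Z}(-k)},\xi^{ -\mathrm{Z}(k)}\rangle$ are the only members of $\mathrm{orb}(U)$ that contain $1$. If $U\in\overline{\mathcal{U}}$, then $k\in\overline{K}$.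
   Context: Elements of $\mathbb{Z}_{2^n-1}$ are exponents of $\xi$. For $k\in K$, the Zech logarithm $\mathrm{Z}(k)$ is defined by $1+\xi^k=\xi^{\mathrm{Z}(k)}$. $\overline{\mathcal{U}}$ denotes the set of $2$-dimensional $\mathbb{F}_2$-subspaces of $V$ that are not contained in any coset $\xi^i\mathbb{F}_{2^m}$, $0\le i\le g-1$, of the subfield $\mathbb{F}_{2^m}$. -}

module Defs where

open import Level using (Level; _⊔_; Lift)
open import Algebra.Bundles using (CommutativeRing)
open import Data.Nat using (ℕ; zero; suc; _^_; _∸_; _<_)
open import Data.Fin using (Fin)
open import Data.Product using (Σ; ∃; _×_; _,_)
open import Data.Sum using (_⊎_)
open import Relation.Nullary using (¬_)
open import Relation.Unary using (Pred)
open import Function.Bundles using (Inverse)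
import Relation.Binary.PropositionalEquality as ≡

module _ {c ℓ : Level} (R : CommutativeRing c ℓ) where
  open CommutativeRing R

  _^ᶠ_ : Carrier → ℕ → Carrier
  x ^ᶠ zero = 1#
  x ^ᶠ suc k = x * (x ^ᶠ k)

  -- R is a field with exactly 2^n elements (hence R ≅ 𝔽_{2^n}, characteristic 2)
  record IsFieldOfOrder2^ (n : ℕ) : Set (c ⊔ ℓ) where
    field
      nontrivial : ¬ (1# ≈ 0#)
      inverses   : ∀ x → ¬ (x ≈ 0#) → ∃ λ y → x * y ≈ 1#
      card       : Inverse setoid (≡.setoid (Fin (2 ^ n)))

  IsPrimitive : Carrier → Set (c ⊔ ℓ)
  IsPrimitive ξ = ¬ (ξ ≈ 0#) × (∀ x → ¬ (x ≈ 0#) → ∃ λ (i : ℕ) → x ≈ ξ ^ᶠ i)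

  -- subsets of V (predicates on the carrier, respecting nothing in particular)
  Subset : Set _
  Subset = Pred Carrier (c ⊔ ℓ)

  -- a, b linearly independent over 𝔽₂
  Independent : Carrier → Carrier → Set ℓ
  Independent a b = ¬ (a ≈ 0#) × ¬ (b ≈ 0#) × ¬ (a ≈ b)

  Span : Carrier → Carrier → Subset
  Span a b x = Lift c (x ≈ 0# ⊎ x ≈ a ⊎ x ≈ b ⊎ x ≈ a + b)

  SameSet : Subset → Subset → Set (c ⊔ ℓ)
  SameSet P Q = ∀ x → (P x → Q x) × (Q x → P x)

  scale : Carrier → Subset → Subset
  scale a U x = ∃ λ y → U y × x ≈ a * y

  InOrb : Subset → Subset → Set (c ⊔ ℓ)
  InOrb U S = ∃ λ a → ¬ (a ≈ 0#) × SameSet (scale a U) S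

  SameOrb : Subset → Subset → Set _
  SameOrb U W = ∀ (S : Subset) → (InOrb U S → InOrb W S) × (InOrb W S → InOrb U S)

  InSubfield : ℕ → Carrier → Set ℓ
  InSubfield m y = y ^ᶠ (2 ^ m) ≈ y

  InCoset : Carrier → ℕ → ℕ → Subset → Set (c ⊔ ℓ)
  InCoset ξ m i U = ∀ x → U x → ∃ λ y → InSubfield m y × x ≈ (ξ ^ᶠ i) * y

  InUbar : Carrier → ℕ → ℕ → Subset → Set (c ⊔ ℓ)
  InUbar ξ m g U = ∀ i → i < g → ¬ InCoset ξ m i U

  -- z is the Zech logarithm Z(k) (exponents in ℤ_{2^n - 1} represented by 0 ≤ z < 2^n - 1)
  IsZech : Carrier → ℕ → ℕ → ℕ → Set ℓ
  IsZech ξ n k z = z < 2 ^ n ∸ 1 × (1# + ξ ^ᶠ k) ≈ ξ ^ᶠ z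

{-# OPTIONS --safe #-}
-- Write b = a u. The members of orb⟨a, b⟩ containing 1 are the images of ⟨a, b⟩ under
-- multiplication by a⁻¹, b⁻¹ and (a + b)⁻¹, namely ⟨1, u⟩, ⟨u⁻¹, 1⟩ and ⟨(1 + u)⁻¹, u (1 + u)⁻¹⟩.
-- In characteristic 2, ⟨p, 1⟩ = ⟨p, 1 + p⟩ and u (1 + u)⁻¹ = (1 + u⁻¹)⁻¹, so for u = ξᵏ these
-- are the three spans of the statement, the Zech logarithms naming 1 + ξᵏ and 1 + ξ⁻ᵏ.
-- If g ∣ k then ξᵏ is a power of ξ^g and so lies in 𝔽_{2^m}; hence ⟨a, b⟩ ⊆ a 𝔽_{2^m},
-- which is one of the cosets ξⁱ 𝔽_{2^m}.
-- The field is given only through its size: ξ^(2ⁿ - 1) = 1 follows by counting nonzero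
-- elements, and then -1 = (-1)^(2ⁿ) = 1 gives characteristic 2.
module Submission where

open import Defs
open import Level using (Level; lift)
open import Algebra.Bundles using (CommutativeRing)
import Algebra.Properties.CommutativeSemiring.Exp as Exp
import Algebra.Properties.Ring as RingProperties
import Data.Nat as ℕ
open ℕ using (ℕ; zero; suc; NonZero; _∸_; _<_; _≤_)
import Data.Nat.Properties as ℕₚ
open import Data.Nat.DivMod using (_%_; _/_; m≡m%n+[m/n]*n; m%n<n)
open import Data.Nat.Divisibility using (_∣_; divides)
open import Data.Fin using (Fin; toℕ; fromℕ<; punchIn; punchOut)
open import Data.Fin.Properties
  using (pigeonhole; injective⇒≤; punchIn-injective; punchInᵢ≢i; punchOut-injective; fromℕ<-injective; toℕ<n)
open import Data.Product using (∃; _×_; _,_; proj₁; proj₂)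
open import Data.Sum using (_⊎_; inj₁; inj₂)
open import Function.Base using (_∘_)
open import Function.Bundles using (Inverse; Injection)
open import Function.Properties.Inverse using (Inverse⇒Injection)
import Function.Construct.Symmetry as Symmetry
open import Relation.Nullary using (¬_; contradiction)
open import Relation.Binary.PropositionalEquality as ≡ using (_≡_; _≢_)

module Arithmetic where
  open import Data.Nat using (_+_; _*_; _^_)
  open ≡.≡-Reasoning

  [tg]2^m≡tg+tN : ∀ {m g N} t → g * (2 ^ m ∸ 1) ≡ N → t * g * 2 ^ m ≡ t * g + t * N
  [tg]2^m≡tg+tN {m} {g} {N} t g[2^m-1]≡N = begin
    t * g * 2 ^ m                ≡⟨ ≡.cong (t * g *_) (ℕₚ.suc-pred (2 ^ m) {{ℕₚ.m^n≢0 2 m}}) ⟨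
    t * g * suc (2 ^ m ∸ 1)      ≡⟨ ℕₚ.*-suc (t * g) _ ⟩
    t * g + t * g * (2 ^ m ∸ 1)  ≡⟨ ≡.cong (t * g +_) (ℕₚ.*-assoc t g _) ⟩
    t * g + t * (g * (2 ^ m ∸ 1)) ≡⟨ ≡.cong (λ h → t * g + t * h) g[2^m-1]≡N ⟩
    t * g + t * N                ∎

  [r+qg]+tg≡r+[q+t]g : ∀ r q t g → r + q * g + t * g ≡ r + (q + t) * g
  [r+qg]+tg≡r+[q+t]g r q t g = begin
    r + q * g + t * g            ≡⟨ ℕₚ.+-assoc r (q * g) (t * g) ⟩
    r + (q * g + t * g)          ≡⟨ ≡.cong (r +_) (ℕₚ.*-distribʳ-+ g q t) ⟨
    r + (q + t) * g              ∎

open Arithmetic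

module Units {c ℓ} (R : CommutativeRing c ℓ) where
  open CommutativeRing R
  open import Relation.Binary.Reasoning.Setoid setoid

  unit⇒≉0 : 1# ≉ 0# → ∀ {x y} → x * y ≈ 1# → x ≉ 0#
  unit⇒≉0 1≉0 {x} {y} xy≈1 x≈0 = 1≉0 (begin
    1#      ≈⟨ xy≈1 ⟨
    x * y   ≈⟨ *-congʳ x≈0 ⟩
    0# * y  ≈⟨ zeroˡ y ⟩
    0#      ∎)

  ≉0-*-unit : ∀ {x y y′} → y * y′ ≈ 1# → x ≉ 0# → x * y ≉ 0#
  ≉0-*-unit {x} {y} {y′} yy′≈1 x≉0 xy≈0 = x≉0 (begin
    x              ≈⟨ *-identityʳ x ⟨
    x * 1#         ≈⟨ *-congˡ yy′≈1 ⟨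
    x * (y * y′)   ≈⟨ *-assoc x y y′ ⟨
    (x * y) * y′   ≈⟨ *-congʳ xy≈0 ⟩
    0# * y′        ≈⟨ zeroˡ y′ ⟩
    0#             ∎)

  inverse-unique : ∀ {x y z} → x * y ≈ 1# → y * z ≈ 1# → x ≈ z
  inverse-unique {x} {y} {z} xy≈1 yz≈1 = begin
    x              ≈⟨ *-identityʳ x ⟨
    x * 1#         ≈⟨ *-congˡ yz≈1 ⟨
    x * (y * z)    ≈⟨ *-assoc x y z ⟨
    (x * y) * z    ≈⟨ *-congʳ xy≈1 ⟩
    1# * z         ≈⟨ *-identityˡ z ⟩
    z              ∎

  *-cancelˡ-unit : ∀ {x y u v} → x * y ≈ 1# → x * u ≈ x * v → u ≈ v
  *-cancelˡ-unit {x} {y} {u} {v} xy≈1 xu≈xv = begin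
    u              ≈⟨ *-identityˡ u ⟨
    1# * u         ≈⟨ *-congʳ yx≈1 ⟨
    y * x * u      ≈⟨ *-assoc y x u ⟩
    y * (x * u)    ≈⟨ *-congˡ xu≈xv ⟩
    y * (x * v)    ≈⟨ *-assoc y x v ⟨
    y * x * v      ≈⟨ *-congʳ yx≈1 ⟩
    1# * v         ≈⟨ *-identityˡ v ⟩
    v              ∎
    where
    yx≈1 : y * x ≈ 1#
    yx≈1 = trans (*-comm y x) xy≈1

module Power {c ℓ} (R : CommutativeRing c ℓ) where
  open CommutativeRing R
  open import Relation.Binary.Reasoning.Setoid setoid
  open Exp commutativeSemiring using () renaming
    ( _^_ to _^ₗ_; ^-congˡ to ^ₗ-congˡ; ^-homo-* to ^ₗ-homo-*
    ; ^-assocʳ to ^ₗ-assocʳ; ^-distrib-* to ^ₗ-distrib-*)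

  infixr 8 _^_
  _^_ : Carrier → ℕ → Carrier
  _^_ = _^ᶠ_ R

  private
    ^≈^ₗ : ∀ x k → x ^ k ≈ x ^ₗ k
    ^≈^ₗ x zero    = refl
    ^≈^ₗ x (suc k) = *-congˡ (^≈^ₗ x k)

  ^-congˡ : ∀ k {x y} → x ≈ y → x ^ k ≈ y ^ k
  ^-congˡ k {x} {y} x≈y = trans (^≈^ₗ x k) (trans (^ₗ-congˡ k x≈y) (sym (^≈^ₗ y k)))

  ^-congʳ : ∀ x {k k′} → k ≡ k′ → x ^ k ≈ x ^ k′
  ^-congʳ x k≡k′ = reflexive (≡.cong (x ^_) k≡k′)

  ^-homo-* : ∀ x m n → x ^ (m ℕ.+ n) ≈ x ^ m * x ^ n
  ^-homo-* x m n = begin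
    x ^ (m ℕ.+ n)      ≈⟨ ^≈^ₗ x (m ℕ.+ n) ⟩
    x ^ₗ (m ℕ.+ n)     ≈⟨ ^ₗ-homo-* x m n ⟩
    x ^ₗ m * x ^ₗ n    ≈⟨ *-cong (^≈^ₗ x m) (^≈^ₗ x n) ⟨
    x ^ m * x ^ n      ∎

  ^-assocʳ : ∀ x m n → (x ^ m) ^ n ≈ x ^ (m ℕ.* n)
  ^-assocʳ x m n = begin
    (x ^ m) ^ n        ≈⟨ ^≈^ₗ (x ^ m) n ⟩
    (x ^ m) ^ₗ n       ≈⟨ ^ₗ-congˡ n (^≈^ₗ x m) ⟩
    (x ^ₗ m) ^ₗ n      ≈⟨ ^ₗ-assocʳ x m n ⟩
    x ^ₗ (m ℕ.* n)     ≈⟨ ^≈^ₗ x (m ℕ.* n) ⟨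
    x ^ (m ℕ.* n)      ∎

  ^-distrib-* : ∀ x y n → (x * y) ^ n ≈ x ^ n * y ^ n
  ^-distrib-* x y n = begin
    (x * y) ^ n        ≈⟨ ^≈^ₗ (x * y) n ⟩
    (x * y) ^ₗ n       ≈⟨ ^ₗ-distrib-* x y n ⟩
    x ^ₗ n * y ^ₗ n    ≈⟨ *-cong (^≈^ₗ x n) (^≈^ₗ y n) ⟨
    x ^ n * y ^ n      ∎

  1^≈1 : ∀ k → 1# ^ k ≈ 1#
  1^≈1 zero    = refl
  1^≈1 (suc k) = trans (*-identityˡ _) (1^≈1 k)

  0^≈0 : ∀ k .{{_ : NonZero k}} → 0# ^ k ≈ 0#
  0^≈0 (suc k) = zeroˡ _

  ^-unit : ∀ {x y} → x * y ≈ 1# → ∀ k → x ^ k * y ^ k ≈ 1#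
  ^-unit {x} {y} xy≈1 k = begin
    x ^ k * y ^ k      ≈⟨ ^-distrib-* x y k ⟨
    (x * y) ^ k        ≈⟨ ^-congˡ k xy≈1 ⟩
    1# ^ k             ≈⟨ 1^≈1 k ⟩
    1#                 ∎

  module _ {x : Carrier} {p : ℕ} (x^p≈1 : x ^ p ≈ 1#) where

    ^-*-period : ∀ t → x ^ (t ℕ.* p) ≈ 1#
    ^-*-period t = begin
      x ^ (t ℕ.* p)    ≈⟨ ^-congʳ x (ℕₚ.*-comm t p) ⟩
      x ^ (p ℕ.* t)    ≈⟨ ^-assocʳ x p t ⟨
      (x ^ p) ^ t      ≈⟨ ^-congˡ t x^p≈1 ⟩
      1# ^ t           ≈⟨ 1^≈1 t ⟩
      1#               ∎

    ^-%-period : .{{_ : NonZero p}} → ∀ e → x ^ e ≈ x ^ (e % p)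
    ^-%-period e = begin
      x ^ e                                ≈⟨ ^-congʳ x (m≡m%n+[m/n]*n e p) ⟩
      x ^ (e % p ℕ.+ (e / p) ℕ.* p)        ≈⟨ ^-homo-* x (e % p) _ ⟩
      x ^ (e % p) * x ^ ((e / p) ℕ.* p)    ≈⟨ *-congˡ (^-*-period (e / p)) ⟩
      x ^ (e % p) * 1#                     ≈⟨ *-identityʳ _ ⟩
      x ^ (e % p)                          ∎

    ^-∸-inverse : ∀ {k} → k ≤ p → x ^ k * x ^ (p ∸ k) ≈ 1#
    ^-∸-inverse {k} k≤p = begin
      x ^ k * x ^ (p ∸ k)      ≈⟨ ^-homo-* x k (p ∸ k) ⟨
      x ^ (k ℕ.+ (p ∸ k))      ≈⟨ ^-congʳ x (ℕₚ.m+[n∸m]≡n k≤p) ⟩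
      x ^ p                    ≈⟨ x^p≈1 ⟩
      1#                       ∎

  InSubfield-0 : ∀ m → InSubfield R m 0#
  InSubfield-0 m = 0^≈0 (2 ℕ.^ m) {{ℕₚ.m^n≢0 2 m}}

  InSubfield-^-cofactor : ∀ {x N m g} → g ℕ.* (2 ℕ.^ m ∸ 1) ≡ N → x ^ N ≈ 1#
                        → ∀ t → InSubfield R m (x ^ (t ℕ.* g))
  InSubfield-^-cofactor {x} {N} {m} {g} g[2^m-1]≡N x^N≈1 t = begin
    (x ^ e) ^ 2 ℕ.^ m              ≈⟨ ^-assocʳ x e (2 ℕ.^ m) ⟩
    x ^ (e ℕ.* 2 ℕ.^ m)            ≈⟨ ^-congʳ x ([tg]2^m≡tg+tN {m} t g[2^m-1]≡N) ⟩
    x ^ (e ℕ.+ t ℕ.* N)            ≈⟨ ^-homo-* x e (t ℕ.* N) ⟩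
    x ^ e * x ^ (t ℕ.* N)          ≈⟨ *-congˡ (^-*-period x^N≈1 t) ⟩
    x ^ e * 1#                     ≈⟨ *-identityʳ _ ⟩
    x ^ e                          ∎
    where
    e : ℕ
    e = t ℕ.* g

module Spans {c ℓ} (R : CommutativeRing c ℓ) where
  open CommutativeRing R
  open Units R

  pattern zero∈ x≈0   = lift (inj₁ x≈0)
  pattern fst∈  x≈p   = lift (inj₂ (inj₁ x≈p))
  pattern snd∈  x≈q   = lift (inj₂ (inj₂ (inj₁ x≈q)))
  pattern sum∈  x≈p+q = lift (inj₂ (inj₂ (inj₂ x≈p+q)))

  SameSet-sym : ∀ {A B} → SameSet R A B → SameSet R B A
  SameSet-sym A≐B x = proj₂ (A≐B x) , proj₁ (A≐B x)

  infixr 5 _⨾_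
  _⨾_ : ∀ {A B C} → SameSet R A B → SameSet R B C → SameSet R A C
  (A≐B ⨾ B≐C) x = proj₁ (B≐C x) ∘ proj₁ (A≐B x) , proj₂ (A≐B x) ∘ proj₂ (B≐C x)

  Span-resp-≈ : ∀ {p q x y} → x ≈ y → Span R p q y → Span R p q x
  Span-resp-≈ x≈y (zero∈ e) = zero∈ (trans x≈y e)
  Span-resp-≈ x≈y (fst∈ e)  = fst∈ (trans x≈y e)
  Span-resp-≈ x≈y (snd∈ e)  = snd∈ (trans x≈y e)
  Span-resp-≈ x≈y (sum∈ e)  = sum∈ (trans x≈y e)

  Span-⊆ : ∀ {p q p′ q′} → Span R p′ q′ p → Span R p′ q′ q → Span R p′ q′ (p + q)
         → ∀ x → Span R p q x → Span R p′ q′ x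
  Span-⊆ _  _  _   x (zero∈ e) = zero∈ e
  Span-⊆ p∈ _  _   x (fst∈ e)  = Span-resp-≈ e p∈
  Span-⊆ _  q∈ _   x (snd∈ e)  = Span-resp-≈ e q∈
  Span-⊆ _  _  pq∈ x (sum∈ e)  = Span-resp-≈ e pq∈

  Span-≐ : ∀ {p q p′ q′}
         → Span R p′ q′ p → Span R p′ q′ q → Span R p′ q′ (p + q)
         → Span R p q p′ → Span R p q q′ → Span R p q (p′ + q′)
         → SameSet R (Span R p q) (Span R p′ q′)
  Span-≐ p∈ q∈ pq∈ p′∈ q′∈ p′q′∈ x = Span-⊆ p∈ q∈ pq∈ x , Span-⊆ p′∈ q′∈ p′q′∈ x

  Span-cong : ∀ {p q p′ q′} → p ≈ p′ → q ≈ q′ → SameSet R (Span R p q) (Span R p′ q′)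
  Span-cong p≈p′ q≈q′ = Span-≐ (fst∈ p≈p′) (snd∈ q≈q′) (sum∈ (+-cong p≈p′ q≈q′))
                               (fst∈ (sym p≈p′)) (snd∈ (sym q≈q′)) (sum∈ (+-cong (sym p≈p′) (sym q≈q′)))

  Span-comm : ∀ {p q} → SameSet R (Span R p q) (Span R q p)
  Span-comm {p} {q} = Span-≐ (snd∈ refl) (fst∈ refl) (sum∈ (+-comm p q))
                             (snd∈ refl) (fst∈ refl) (sum∈ (+-comm q p))

  scale-Span : ∀ {l p q} → SameSet R (scale R l (Span R p q)) (Span R (l * p) (l * q))
  scale-Span {l} {p} {q} x = to , from
    where
    to : scale R l (Span R p q) x → Span R (l * p) (l * q) x
    to (y , zero∈ e , x≈ly) = zero∈ (trans x≈ly (trans (*-congˡ e) (zeroʳ l)))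
    to (y , fst∈ e  , x≈ly) = fst∈ (trans x≈ly (*-congˡ e))
    to (y , snd∈ e  , x≈ly) = snd∈ (trans x≈ly (*-congˡ e))
    to (y , sum∈ e  , x≈ly) = sum∈ (trans x≈ly (trans (*-congˡ e) (distribˡ l p q)))
    from : Span R (l * p) (l * q) x → scale R l (Span R p q) x
    from (zero∈ e) = 0# , zero∈ refl , trans e (sym (zeroʳ l))
    from (fst∈ e)  = p , fst∈ refl , e
    from (snd∈ e)  = q , snd∈ refl , e
    from (sum∈ e)  = p + q , sum∈ refl , trans e (sym (distribˡ l p q))

  scale-congˡ : ∀ {l l′ A} → l ≈ l′ → SameSet R (scale R l A) (scale R l′ A)
  scale-congˡ l≈l′ x = (λ (y , y∈ , e) → y , y∈ , trans e (*-congʳ l≈l′))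
                     , (λ (y , y∈ , e) → y , y∈ , trans e (*-congʳ (sym l≈l′)))

  scale-congʳ : ∀ {l A B} → SameSet R A B → SameSet R (scale R l A) (scale R l B)
  scale-congʳ A≐B x = (λ (y , y∈ , e) → y , proj₁ (A≐B y) y∈ , e)
                    , (λ (y , y∈ , e) → y , proj₂ (A≐B y) y∈ , e)

  scale-* : ∀ {l l′ A} → SameSet R (scale R l (scale R l′ A)) (scale R (l * l′) A)
  scale-* {l} {l′} x =
      (λ (_ , (z , z∈ , y≈l′z) , x≈ly) → z , z∈ , trans x≈ly (trans (*-congˡ y≈l′z) (sym (*-assoc l l′ z))))
    , (λ (z , z∈ , x≈ll′z) → l′ * z , (z , z∈ , refl) , trans x≈ll′z (*-assoc l l′ z))

  SameOrb-scale : ∀ {l x U W} → l * x ≈ 1# → SameSet R (scale R l U) W → SameOrb R U W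
  SameOrb-scale {l} {x} {U} {W} lx≈1 lU≐W S = from-U , from-W
    where
    from-U : InOrb R U S → InOrb R W S
    from-U (α , α≉0 , αU≐S) =
      α * x , ≉0-*-unit (trans (*-comm x l) lx≈1) α≉0 ,
      scale-congʳ (SameSet-sym lU≐W) ⨾ scale-* ⨾ scale-congˡ αxl≈α ⨾ αU≐S
      where
      αxl≈α : α * x * l ≈ α
      αxl≈α = trans (*-assoc α x l) (trans (*-congˡ (trans (*-comm x l) lx≈1)) (*-identityʳ α))
    from-W : InOrb R W S → InOrb R U S
    from-W (α , α≉0 , αW≐S) =
      α * l , ≉0-*-unit lx≈1 α≉0 , SameSet-sym scale-* ⨾ scale-congʳ lU≐W ⨾ αW≐S

HasCharacteristic2 : ∀ {c ℓ} → CommutativeRing c ℓ → Set ℓ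
HasCharacteristic2 R = 1# + 1# ≈ 0#
  where open CommutativeRing R

module Characteristic2 {c ℓ} (R : CommutativeRing c ℓ) (1+1≈0 : HasCharacteristic2 R) where
  open CommutativeRing R
  open import Relation.Binary.Reasoning.Setoid setoid
  open Units R
  open Power R
  open Spans R

  x+x≈0 : ∀ x → x + x ≈ 0#
  x+x≈0 x = begin
    x + x              ≈⟨ +-cong (*-identityʳ x) (*-identityʳ x) ⟨
    x * 1# + x * 1#    ≈⟨ distribˡ x 1# 1# ⟨
    x * (1# + 1#)      ≈⟨ *-congˡ 1+1≈0 ⟩
    x * 0#             ≈⟨ zeroʳ x ⟩
    0#                 ∎

  x+[x+y]≈y : ∀ x y → x + (x + y) ≈ y
  x+[x+y]≈y x y = begin
    x + (x + y)        ≈⟨ +-assoc x x y ⟨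
    (x + x) + y        ≈⟨ +-congʳ (x+x≈0 x) ⟩
    0# + y             ≈⟨ +-identityˡ y ⟩
    y                  ∎

  x+y≈0⇒x≈y : ∀ {x y} → x + y ≈ 0# → x ≈ y
  x+y≈0⇒x≈y {x} {y} x+y≈0 = begin
    x                  ≈⟨ +-identityʳ x ⟨
    x + 0#             ≈⟨ +-congˡ x+y≈0 ⟨
    x + (x + y)        ≈⟨ x+[x+y]≈y x y ⟩
    y                  ∎

  ^2-distrib-+ : ∀ x y → (x + y) ^ 2 ≈ x ^ 2 + y ^ 2
  ^2-distrib-+ x y = begin
    (x + y) ^ 2                          ≈⟨ *-congˡ (*-identityʳ (x + y)) ⟩
    (x + y) * (x + y)                    ≈⟨ distribʳ (x + y) x y ⟩
    x * (x + y) + y * (x + y)            ≈⟨ +-cong (distribˡ x x y) (distribˡ y x y) ⟩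
    (x * x + x * y) + (y * x + y * y)    ≈⟨ +-congˡ (+-congʳ (*-comm y x)) ⟩
    (x * x + x * y) + (x * y + y * y)    ≈⟨ +-assoc (x * x) (x * y) _ ⟩
    x * x + (x * y + (x * y + y * y))    ≈⟨ +-congˡ (x+[x+y]≈y (x * y) (y * y)) ⟩
    x * x + y * y                        ≈⟨ +-cong (*-congˡ (*-identityʳ x)) (*-congˡ (*-identityʳ y)) ⟨
    x ^ 2 + y ^ 2                        ∎

  ^2^-distrib-+ : ∀ m x y → (x + y) ^ 2 ℕ.^ m ≈ x ^ 2 ℕ.^ m + y ^ 2 ℕ.^ m
  ^2^-distrib-+ zero    x y = trans (*-identityʳ (x + y)) (sym (+-cong (*-identityʳ x) (*-identityʳ y)))
  ^2^-distrib-+ (suc m) x y = begin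
    (x + y) ^ (2 ℕ.* 2 ℕ.^ m)                 ≈⟨ ^-assocʳ (x + y) 2 (2 ℕ.^ m) ⟨
    ((x + y) ^ 2) ^ 2 ℕ.^ m                   ≈⟨ ^-congˡ (2 ℕ.^ m) (^2-distrib-+ x y) ⟩
    (x ^ 2 + y ^ 2) ^ 2 ℕ.^ m                 ≈⟨ ^2^-distrib-+ m (x ^ 2) (y ^ 2) ⟩
    (x ^ 2) ^ 2 ℕ.^ m + (y ^ 2) ^ 2 ℕ.^ m     ≈⟨ +-cong (^-assocʳ x 2 (2 ℕ.^ m)) (^-assocʳ y 2 (2 ℕ.^ m)) ⟩
    x ^ (2 ℕ.* 2 ℕ.^ m) + y ^ (2 ℕ.* 2 ℕ.^ m) ∎

  InSubfield-+ : ∀ m {x y} → InSubfield R m x → InSubfield R m y → InSubfield R m (x + y)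
  InSubfield-+ m x∈ y∈ = trans (^2^-distrib-+ m _ _) (+-cong x∈ y∈)

  Span-InCoset : ∀ {ξ m i a b y y′} → InSubfield R m y → InSubfield R m y′
               → a ≈ ξ ^ i * y → b ≈ ξ ^ i * y′ → InCoset R ξ m i (Span R a b)
  Span-InCoset {m = m} _ _ _ _ x (zero∈ e) = 0# , InSubfield-0 m , trans e (sym (zeroʳ _))
  Span-InCoset {y = y} y∈ _ a≈ _ x (fst∈ e) = y , y∈ , trans e a≈
  Span-InCoset {y′ = y′} _ y′∈ _ b≈ x (snd∈ e) = y′ , y′∈ , trans e b≈
  Span-InCoset {m = m} {y = y} {y′} y∈ y′∈ a≈ b≈ x (sum∈ e) =
    y + y′ , InSubfield-+ m y∈ y′∈ , trans e (trans (+-cong a≈ b≈) (sym (distribˡ _ y y′)))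

  Span-+ : ∀ {p q} → SameSet R (Span R p q) (Span R p (p + q))
  Span-+ {p} {q} = Span-≐ (fst∈ refl) (sum∈ (sym (x+[x+y]≈y p q))) (snd∈ refl)
                          (fst∈ refl) (sum∈ refl) (snd∈ (x+[x+y]≈y p q))

  Span-1+ : ∀ {p q} → 1# + p ≈ q → SameSet R (Span R p 1#) (Span R p q)
  Span-1+ {p} 1+p≈q = Span-+ ⨾ Span-cong refl (trans (+-comm p 1#) 1+p≈q)

  -- Applied with u = ξᵏ: then z = ξ^Z(k), w = ξ^-Z(k), and the primed elements are the same for -k.
  module Representatives {a b u u′ z z′ w w′ : Carrier}
    (b≈au : b ≈ a * u) (uu′≈1 : u * u′ ≈ 1#)
    (1+u≈z : 1# + u ≈ z) (1+u′≈z′ : 1# + u′ ≈ z′)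
    (zw≈1 : z * w ≈ 1#) (z′w′≈1 : z′ * w′ ≈ 1#) where

    private
      lb≈la*u : ∀ l → l * b ≈ l * a * u
      lb≈la*u l = trans (*-congˡ b≈au) (sym (*-assoc l a u))

    scale-a⁻¹ : ∀ {l} → l * a ≈ 1# → SameSet R (scale R l (Span R a b)) (Span R u z)
    scale-a⁻¹ {l} la≈1 = scale-Span ⨾ Span-cong la≈1 lb≈u ⨾ Span-comm ⨾ Span-1+ 1+u≈z
      where
      lb≈u : l * b ≈ u
      lb≈u = trans (lb≈la*u l) (trans (*-congʳ la≈1) (*-identityˡ u))

    scale-b⁻¹ : ∀ {l} → l * b ≈ 1# → SameSet R (scale R l (Span R a b)) (Span R u′ z′)
    scale-b⁻¹ {l} lb≈1 = scale-Span ⨾ Span-cong la≈u′ lb≈1 ⨾ Span-1+ 1+u′≈z′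
      where
      la≈u′ : l * a ≈ u′
      la≈u′ = inverse-unique (trans (sym (lb≈la*u l)) lb≈1) uu′≈1

    scale-[a+b]⁻¹ : ∀ {l} → l * (a + b) ≈ 1# → SameSet R (scale R l (Span R a b)) (Span R w′ w)
    scale-[a+b]⁻¹ {l} l[a+b]≈1 = scale-Span ⨾ Span-cong la≈w lb≈w′ ⨾ Span-comm
      where
      la≈w : l * a ≈ w
      la≈w = inverse-unique (begin
        l * a * z               ≈⟨ *-congˡ 1+u≈z ⟨
        l * a * (1# + u)        ≈⟨ distribˡ (l * a) 1# u ⟩
        l * a * 1# + l * a * u  ≈⟨ +-cong (*-identityʳ (l * a)) (sym (lb≈la*u l)) ⟩
        l * a + l * b           ≈⟨ distribˡ l a b ⟨
        l * (a + b)             ≈⟨ l[a+b]≈1 ⟩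
        1#                      ∎) zw≈1
      wu≈w′ : w * u ≈ w′
      wu≈w′ = inverse-unique (begin
        w * u * z′              ≈⟨ *-assoc w u z′ ⟩
        w * (u * z′)            ≈⟨ *-congˡ (*-congˡ 1+u′≈z′) ⟨
        w * (u * (1# + u′))     ≈⟨ *-congˡ (distribˡ u 1# u′) ⟩
        w * (u * 1# + u * u′)   ≈⟨ *-congˡ (+-cong (*-identityʳ u) uu′≈1) ⟩
        w * (u + 1#)            ≈⟨ *-congˡ (trans (+-comm u 1#) 1+u≈z) ⟩
        w * z                   ≈⟨ *-comm w z ⟩
        z * w                   ≈⟨ zw≈1 ⟩
        1#                      ∎) z′w′≈1
      lb≈w′ : l * b ≈ w′
      lb≈w′ = trans (lb≈la*u l) (trans (*-congʳ la≈w) wu≈w′)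

    members-containing-1 : 1# ≉ 0# → ∀ S → InOrb R (Span R a b) S → S 1#
      → SameSet R S (Span R u z) ⊎ SameSet R S (Span R u′ z′) ⊎ SameSet R S (Span R w′ w)
    members-containing-1 1≉0 S (α , _ , αU≐S) 1∈S with proj₂ (αU≐S 1#) 1∈S
    ... | y , zero∈ y≈0  , 1≈αy = contradiction (trans 1≈αy (trans (*-congˡ y≈0) (zeroʳ α))) 1≉0
    ... | y , fst∈ y≈a   , 1≈αy =
      inj₁ (SameSet-sym αU≐S ⨾ scale-a⁻¹ (sym (trans 1≈αy (*-congˡ y≈a))))
    ... | y , snd∈ y≈b   , 1≈αy =
      inj₂ (inj₁ (SameSet-sym αU≐S ⨾ scale-b⁻¹ (sym (trans 1≈αy (*-congˡ y≈b)))))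
    ... | y , sum∈ y≈a+b , 1≈αy =
      inj₂ (inj₂ (SameSet-sym αU≐S ⨾ scale-[a+b]⁻¹ (sym (trans 1≈αy (*-congˡ y≈a+b)))))

module FiniteField {c ℓ} (R : CommutativeRing c ℓ) (n : ℕ) (F : IsFieldOfOrder2^ R (suc n))
                   (ξ : CommutativeRing.Carrier R) (ξ-primitive : IsPrimitive R ξ) where
  open CommutativeRing R
  open import Relation.Binary.Reasoning.Setoid setoid
  open IsFieldOfOrder2^ F
  open RingProperties ring using (-1*x≈-x; -‿involutive; -0#≈0#)
  open Units R
  open Power R

  N : ℕ
  N = 2 ℕ.^ suc n ∸ 1

  instance
    N-nonZero : NonZero N
    N-nonZero = ℕ.>-nonZero (ℕₚ.m<n⇒0<n∸m (ℕₚ.*-monoʳ-≤ 2 (ℕₚ.m^n>0 2 n)))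

  private
    1+N≡2^[1+n] : suc N ≡ 2 ℕ.^ suc n
    1+N≡2^[1+n] = ℕₚ.suc-pred (2 ℕ.^ suc n) {{ℕₚ.m^n≢0 2 (suc n)}}

    card′ : Inverse setoid (≡.setoid (Fin (suc N)))
    card′ = ≡.subst (λ t → Inverse setoid (≡.setoid (Fin t))) (≡.sym 1+N≡2^[1+n]) card

    open Inverse card′ using (to-cong; strictlyInverseˡ) renaming (to to index; from to element)

    index-injective : ∀ {x y} → index x ≡ index y → x ≈ y
    index-injective = Injection.injective (Inverse⇒Injection card′)

    element-injective : ∀ {i j} → element i ≈ element j → i ≡ j
    element-injective = Injection.injective (Inverse⇒Injection (Symmetry.inverse card′))

    nonzero : Fin N → Carrier
    nonzero i = element (punchIn (index 0#) i)

    nonzero-≉0 : ∀ i → nonzero i ≉ 0#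
    nonzero-≉0 i i≈0 = punchInᵢ≢i (index 0#) i (≡.trans (≡.sym (strictlyInverseˡ _)) (to-cong i≈0))

    nonzero-injective : ∀ {i j} → nonzero i ≈ nonzero j → i ≡ j
    nonzero-injective = punchIn-injective (index 0#) _ _ ∘ element-injective

    index0≢index : ∀ {x} → x ≉ 0# → index 0# ≢ index x
    index0≢index x≉0 = x≉0 ∘ index-injective ∘ ≡.sym

    nonzeroIndex : ∀ x → x ≉ 0# → Fin N
    nonzeroIndex x x≉0 = punchOut (index0≢index x≉0)

    nonzeroIndex-injective : ∀ {x y} (x≉0 : x ≉ 0#) (y≉0 : y ≉ 0#)
                           → nonzeroIndex x x≉0 ≡ nonzeroIndex y y≉0 → x ≈ y
    nonzeroIndex-injective x≉0 y≉0 =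
      index-injective ∘ punchOut-injective (index0≢index x≉0) (index0≢index y≉0)

    ξ⁻¹ : Carrier
    ξ⁻¹ = proj₁ (inverses ξ (proj₁ ξ-primitive))

    ξ^-unit : ∀ i → ξ ^ i * ξ⁻¹ ^ i ≈ 1#
    ξ^-unit = ^-unit (proj₂ (inverses ξ (proj₁ ξ-primitive)))

  ξ^≉0 : ∀ i → ξ ^ i ≉ 0#
  ξ^≉0 i = unit⇒≉0 nontrivial (ξ^-unit i)

  -- The nonzero elements are the ξ^e with e < d, so there are at most d of them.
  N≤period : ∀ {d} .{{_ : NonZero d}} → ξ ^ d ≈ 1# → N ≤ d
  N≤period {d} ξ^d≈1 = injective⇒≤ residue-injective
    where
    exponent : Fin N → ℕ
    exponent i = proj₁ (proj₂ ξ-primitive (nonzero i) (nonzero-≉0 i))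
    residue : Fin N → Fin d
    residue i = fromℕ< (m%n<n (exponent i) d)
    nonzero≈ξ^residue : ∀ i → nonzero i ≈ ξ ^ (exponent i % d)
    nonzero≈ξ^residue i = trans (proj₂ (proj₂ ξ-primitive (nonzero i) (nonzero-≉0 i)))
                                (^-%-period ξ^d≈1 (exponent i))
    residue-injective : ∀ {i j} → residue i ≡ residue j → i ≡ j
    residue-injective {i} {j} ri≡rj = nonzero-injective (begin
      nonzero i               ≈⟨ nonzero≈ξ^residue i ⟩
      ξ ^ (exponent i % d)    ≈⟨ ^-congʳ ξ (fromℕ<-injective _ _ _ _ ri≡rj) ⟩
      ξ ^ (exponent j % d)    ≈⟨ nonzero≈ξ^residue j ⟨
      nonzero j               ∎)

  private
    indexOfPower : Fin (suc N) → Fin N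
    indexOfPower e = nonzeroIndex (ξ ^ toℕ e) (ξ^≉0 (toℕ e))

  -- ξ⁰, …, ξᴺ are N + 1 nonzero elements, so two of them coincide.
  period≤N : ∃ λ d → 0 < d × d ≤ N × ξ ^ d ≈ 1#
  period≤N with i , j , i<j , same ← pigeonhole (ℕₚ.n<1+n N) indexOfPower =
    d , ℕₚ.m<n⇒0<n∸m i<j , ℕₚ.≤-trans (ℕₚ.m∸n≤m (toℕ j) (toℕ i)) (ℕₚ.≤-pred (toℕ<n j)) , ξ^d≈1
    where
    d : ℕ
    d = toℕ j ∸ toℕ i
    ξ^d≈1 : ξ ^ d ≈ 1#
    ξ^d≈1 = *-cancelˡ-unit (ξ^-unit (toℕ i)) (begin
      ξ ^ toℕ i * ξ ^ d       ≈⟨ ^-homo-* ξ (toℕ i) d ⟨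
      ξ ^ (toℕ i ℕ.+ d)       ≈⟨ ^-congʳ ξ (ℕₚ.m+[n∸m]≡n (ℕₚ.<⇒≤ i<j)) ⟩
      ξ ^ toℕ j               ≈⟨ nonzeroIndex-injective (ξ^≉0 (toℕ i)) (ξ^≉0 (toℕ j)) same ⟨
      ξ ^ toℕ i               ≈⟨ *-identityʳ _ ⟨
      ξ ^ toℕ i * 1#          ∎)

  ξ^N≈1 : ξ ^ N ≈ 1#
  ξ^N≈1 =
    let d , 0<d , d≤N , ξ^d≈1 = period≤N
    in trans (^-congʳ ξ (ℕₚ.≤-antisym (N≤period {{ℕ.>-nonZero 0<d}} ξ^d≈1) d≤N)) ξ^d≈1

  ξ^-∸-inverse : ∀ {e} → e < N → ξ ^ e * ξ ^ (N ∸ e) ≈ 1#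
  ξ^-∸-inverse = ^-∸-inverse ξ^N≈1 ∘ ℕₚ.<⇒≤

  log : ∀ x → x ≉ 0# → ∃ λ k → k < N × x ≈ ξ ^ k
  log x x≉0 =
    let e , x≈ξ^e = proj₂ ξ-primitive x x≉0
    in e % N , m%n<n e N , trans x≈ξ^e (^-%-period ξ^N≈1 e)

  ^N≈1 : ∀ {x} → x ≉ 0# → x ^ N ≈ 1#
  ^N≈1 {x} x≉0 =
    let e , x≈ξ^e = proj₂ ξ-primitive x x≉0
    in begin
      x ^ N             ≈⟨ ^-congˡ N x≈ξ^e ⟩
      (ξ ^ e) ^ N       ≈⟨ ^-assocʳ ξ e N ⟩
      ξ ^ (e ℕ.* N)     ≈⟨ ^-*-period ξ^N≈1 e ⟩
      1#                ∎

  -1≈1 : - 1# ≈ 1#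
  -1≈1 = begin
    - 1#                       ≈⟨ *-identityʳ (- 1#) ⟨
    - 1# * 1#                  ≈⟨ *-congˡ (^N≈1 -1≉0) ⟨
    (- 1#) ^ suc N             ≈⟨ ^-congʳ (- 1#) 1+N≡2^[1+n] ⟩
    (- 1#) ^ (2 ℕ.* 2 ℕ.^ n)   ≈⟨ ^-assocʳ (- 1#) 2 (2 ℕ.^ n) ⟨
    ((- 1#) ^ 2) ^ 2 ℕ.^ n     ≈⟨ ^-congˡ (2 ℕ.^ n) [-1]²≈1 ⟩
    1# ^ 2 ℕ.^ n               ≈⟨ 1^≈1 (2 ℕ.^ n) ⟩
    1#                         ∎
    where
    -1≉0 : - 1# ≉ 0#
    -1≉0 -1≈0 = nontrivial (trans (sym (-‿involutive 1#)) (trans (-‿cong -1≈0) -0#≈0#))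
    [-1]²≈1 : (- 1#) ^ 2 ≈ 1#
    [-1]²≈1 = trans (*-congˡ (*-identityʳ (- 1#))) (trans (-1*x≈-x (- 1#)) (-‿involutive 1#))

  characteristic-2 : HasCharacteristic2 R
  characteristic-2 = trans (+-congˡ (sym -1≈1)) (-‿inverseʳ 1#)

  open Characteristic2 R characteristic-2 using (x+y≈0⇒x≈y)

  zech : ∀ e → ξ ^ e ≉ 1# → ∃ λ z → IsZech R ξ (suc n) e z
  zech e ξ^e≉1 = log (1# + ξ ^ e) (ξ^e≉1 ∘ sym ∘ x+y≈0⇒x≈y)

module Orbit {c ℓ} (R : CommutativeRing c ℓ) (n : ℕ) (F : IsFieldOfOrder2^ R (suc n))
             (ξ : CommutativeRing.Carrier R) (ξ-primitive : IsPrimitive R ξ)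
             (a b : CommutativeRing.Carrier R) (a⊥b : Independent R a b) where
  open CommutativeRing R
  open import Relation.Binary.Reasoning.Setoid setoid
  open IsFieldOfOrder2^ F
  open Power R
  open Spans R
  open FiniteField R n F ξ ξ-primitive
  open Characteristic2 R characteristic-2

  private
    a≉0 : a ≉ 0#
    a≉0 = proj₁ a⊥b

    inverse : ∀ x → x ≉ 0# → ∃ λ l → l * x ≈ 1#
    inverse x x≉0 = let l , xl≈1 = inverses x x≉0 in l , trans (*-comm l x) xl≈1

    a⁻¹ : Carrier
    a⁻¹ = proj₁ (inverses a a≉0)

    u : Carrier
    u = a⁻¹ * b

    b≈au : b ≈ a * u
    b≈au = begin
      b                ≈⟨ *-identityˡ b ⟨
      1# * b           ≈⟨ *-congʳ (proj₂ (inverses a a≉0)) ⟨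
      a * a⁻¹ * b      ≈⟨ *-assoc a a⁻¹ b ⟩
      a * u            ∎

    u≉0 : u ≉ 0#
    u≉0 u≈0 = proj₁ (proj₂ a⊥b) (trans b≈au (trans (*-congˡ u≈0) (zeroʳ a)))

    u≉1 : u ≉ 1#
    u≉1 u≈1 = proj₂ (proj₂ a⊥b) (sym (trans b≈au (trans (*-congˡ u≈1) (*-identityʳ a))))

  k : ℕ
  k = proj₁ (log u u≉0)

  k<N : k < N
  k<N = proj₁ (proj₂ (log u u≉0))

  u≈ξ^k : u ≈ ξ ^ k
  u≈ξ^k = proj₂ (proj₂ (log u u≉0))

  1≤k : 1 ≤ k
  1≤k = ℕₚ.n≢0⇒n>0 (λ k≡0 → u≉1 (trans u≈ξ^k (^-congʳ ξ k≡0)))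

  ξ^k*ξ^[N-k]≈1 : ξ ^ k * ξ ^ (N ∸ k) ≈ 1#
  ξ^k*ξ^[N-k]≈1 = ξ^-∸-inverse k<N

  ξ^k≉1 : ξ ^ k ≉ 1#
  ξ^k≉1 ξ^k≈1 = u≉1 (trans u≈ξ^k ξ^k≈1)

  ξ^[N-k]≉1 : ξ ^ (N ∸ k) ≉ 1#
  ξ^[N-k]≉1 ξ^[N-k]≈1 = ξ^k≉1 (begin
    ξ ^ k                  ≈⟨ *-identityʳ (ξ ^ k) ⟨
    ξ ^ k * 1#             ≈⟨ *-congˡ ξ^[N-k]≈1 ⟨
    ξ ^ k * ξ ^ (N ∸ k)    ≈⟨ ξ^k*ξ^[N-k]≈1 ⟩
    1#                     ∎)

  z₁ : ℕ
  z₁ = proj₁ (zech k ξ^k≉1)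

  zech₁ : IsZech R ξ (suc n) k z₁
  zech₁ = proj₂ (zech k ξ^k≉1)

  z₂ : ℕ
  z₂ = proj₁ (zech (N ∸ k) ξ^[N-k]≉1)

  zech₂ : IsZech R ξ (suc n) (N ∸ k) z₂
  zech₂ = proj₂ (zech (N ∸ k) ξ^[N-k]≉1)

  open Representatives (trans b≈au (*-congˡ u≈ξ^k)) ξ^k*ξ^[N-k]≈1 (proj₂ zech₁) (proj₂ zech₂)
                       (ξ^-∸-inverse (proj₁ zech₁)) (ξ^-∸-inverse (proj₁ zech₂))
    public

  orbit₁ : SameOrb R (Span R a b) (Span R (ξ ^ k) (ξ ^ z₁))
  orbit₁ = let l , la≈1 = inverse a a≉0 in SameOrb-scale la≈1 (scale-a⁻¹ la≈1)

  orbit₂ : SameOrb R (Span R a b) (Span R (ξ ^ (N ∸ k)) (ξ ^ z₂))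
  orbit₂ = let l , lb≈1 = inverse b (proj₁ (proj₂ a⊥b)) in SameOrb-scale lb≈1 (scale-b⁻¹ lb≈1)

  orbit₃ : SameOrb R (Span R a b) (Span R (ξ ^ (N ∸ z₂)) (ξ ^ (N ∸ z₁)))
  orbit₃ = let l , l[a+b]≈1 = inverse (a + b) a+b≉0
           in SameOrb-scale l[a+b]≈1 (scale-[a+b]⁻¹ l[a+b]≈1)
    where
    a+b≉0 : a + b ≉ 0#
    a+b≉0 = proj₂ (proj₂ a⊥b) ∘ x+y≈0⇒x≈y

  Ubar⇒g∤k : ∀ m g → g ℕ.* (2 ℕ.^ m ∸ 1) ≡ N → InUbar R ξ m g (Span R a b) → ¬ (g ∣ k)
  Ubar⇒g∤k m g g[2^m-1]≡N U∈Ubar (divides t k≡tg) =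
    U∈Ubar (j % g) (m%n<n j g)
      (Span-InCoset {ξ} {m} {j % g} (cofactor q) (cofactor (q ℕ.+ t)) a≈ b≈)
    where
    instance
      g-nonZero : NonZero g
      g-nonZero = ℕₚ.m*n≢0⇒m≢0 g {{≡.subst NonZero (≡.sym g[2^m-1]≡N) N-nonZero}}
    j q : ℕ
    j = proj₁ (proj₂ ξ-primitive a a≉0)
    q = j / g
    a≈ξ^j : a ≈ ξ ^ j
    a≈ξ^j = proj₂ (proj₂ ξ-primitive a a≉0)
    cofactor : ∀ t → InSubfield R m (ξ ^ (t ℕ.* g))
    cofactor = InSubfield-^-cofactor {m = m} g[2^m-1]≡N ξ^N≈1
    ξ^-split : ∀ {e} f → e ≡ j % g ℕ.+ f ℕ.* g → ξ ^ e ≈ ξ ^ (j % g) * ξ ^ (f ℕ.* g)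
    ξ^-split f e≡ = trans (^-congʳ ξ e≡) (^-homo-* ξ (j % g) (f ℕ.* g))
    j+k≡ : j ℕ.+ k ≡ j % g ℕ.+ (q ℕ.+ t) ℕ.* g
    j+k≡ = ≡.trans (≡.cong₂ ℕ._+_ (m≡m%n+[m/n]*n j g) k≡tg) ([r+qg]+tg≡r+[q+t]g (j % g) q t g)
    a≈ : a ≈ ξ ^ (j % g) * ξ ^ (q ℕ.* g)
    a≈ = trans a≈ξ^j (ξ^-split q (m≡m%n+[m/n]*n j g))
    b≈ : b ≈ ξ ^ (j % g) * ξ ^ ((q ℕ.+ t) ℕ.* g)
    b≈ = begin
      b                  ≈⟨ b≈au ⟩
      a * u              ≈⟨ *-cong a≈ξ^j u≈ξ^k ⟩
      ξ ^ j * ξ ^ k      ≈⟨ ^-homo-* ξ j k ⟨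
      ξ ^ (j ℕ.+ k)      ≈⟨ ξ^-split (q ℕ.+ t) j+k≡ ⟩
      ξ ^ (j % g) * ξ ^ ((q ℕ.+ t) ℕ.* g) ∎

-- Imported only here: in the modules above, _*_ and _^_ are the ring operations.
open import Data.Nat using (_*_; _^_)

proposition2 : ∀ {c ℓ : Level} (n m s : ℕ) → 1 ≤ m → 2 ≤ s → n ≡ s * m → 6 ∣ (n ∸ m)
    → (R : CommutativeRing c ℓ) → IsFieldOfOrder2^ R n
    → (ξ : CommutativeRing.Carrier R) → IsPrimitive R ξ
    → (g : ℕ) → g * (2 ^ m ∸ 1) ≡ 2 ^ n ∸ 1
    → ∀ (a b : CommutativeRing.Carrier R) → Independent R a b
    → ∃ λ (k : ℕ) → 1 ≤ k × k < 2 ^ n ∸ 1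
        × ∃ λ (z₁ : ℕ) → ∃ λ (z₂ : ℕ)
        → IsZech R ξ n k z₁
        × IsZech R ξ n (2 ^ n ∸ 1 ∸ k) z₂
        × SameOrb R (Span R a b) (Span R (_^ᶠ_ R ξ k) (_^ᶠ_ R ξ z₁))
        × SameOrb R (Span R a b) (Span R (_^ᶠ_ R ξ (2 ^ n ∸ 1 ∸ k)) (_^ᶠ_ R ξ z₂))
        × SameOrb R (Span R a b) (Span R (_^ᶠ_ R ξ (2 ^ n ∸ 1 ∸ z₂)) (_^ᶠ_ R ξ (2 ^ n ∸ 1 ∸ z₁)))
        × (∀ (S : Subset R) → InOrb R (Span R a b) S → S (CommutativeRing.1# R)
            → SameSet R S (Span R (_^ᶠ_ R ξ k) (_^ᶠ_ R ξ z₁))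
              ⊎ SameSet R S (Span R (_^ᶠ_ R ξ (2 ^ n ∸ 1 ∸ k)) (_^ᶠ_ R ξ z₂))
              ⊎ SameSet R S (Span R (_^ᶠ_ R ξ (2 ^ n ∸ 1 ∸ z₂)) (_^ᶠ_ R ξ (2 ^ n ∸ 1 ∸ z₁))))
        × (InUbar R ξ m g (Span R a b) → ¬ (g ∣ k))
proposition2 zero m s 1≤m 2≤s 0≡sm =
  contradiction (ℕₚ.≤-trans (ℕₚ.*-mono-≤ 2≤s 1≤m) (ℕₚ.≤-reflexive (≡.sym 0≡sm))) λ ()
proposition2 (suc n) m _ _ _ _ _ R F ξ ξ-primitive g g[2^m-1]≡N a b a⊥b =
  k , 1≤k , k<N , z₁ , z₂ , zech₁ , zech₂ , orbit₁ , orbit₂ , orbit₃ ,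
  members-containing-1 nontrivial , Ubar⇒g∤k m g g[2^m-1]≡N
  where
  open Orbit R n F ξ ξ-primitive a b a⊥b
  open IsFieldOfOrder2^ F using (nontrivial)
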